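{- Let $A$ be a set of $k$ positive integers and let $H$ be a set of $r$ positive integers with $\max(H)=h_{r}$. Then \[ |HA| \geq h_{r}(k-1)+r. \] This lower bound is optimal: for all positive integers $k,r$, taking $A=[1,k]$ and $H=[1,r]$ gives $|HA| = h_r(k-1)+r$ (here $h_r=r$).
   Context: For a positive integer $h$ and a finite set $A$ of integers, $hA$ denotes the set of all integers expressible as a sum of $h$ (not necessarily distinct) elements of $A$. For a finite set $H$ of positive integers, $HA := \bigcup_{h\in H} hA$. For integers $a\le b$, $[a,b]=\{a,a+1,\ldots,b\}$. -}

module Defs where

open import Data.Nat using (ℕ; zero; suc; _+_)
open import Data.Nat.Properties using (_≟_)
open import Data.List using (List; []; _∷_; map; concatMap; length; deduplicate; upTo)

-- hA : the list of all sums of h (not necessarily distinct) elements of A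
-- (with repetitions); 0A = {0}.
sumList : ℕ → List ℕ → List ℕ
sumList zero    A = 0 ∷ []
sumList (suc h) A = concatMap (λ a → map (a +_) (sumList h A)) A

HsumList : List ℕ → List ℕ → List ℕ
HsumList H A = concatMap (λ h → sumList h A) H

cardHA : List ℕ → List ℕ → ℕ
cardHA H A = length (deduplicate _≟_ (HsumList H A))

interval1 : ℕ → List ℕ
interval1 n = map suc (upTo n)

-- Let a₁ = min A and T = A ∖ {a₁}. Building hA one summand at a time, the sets
-- C₀ = {0} and C_{h+1} = (a₁ + C_h) ∪ (T + h·max A) lie in hA, and the union is
-- disjoint because every element of a₁ + C_h is at most a₁ + h·max A. Hence
-- |C_h| = h(k − 1) + 1. Every element of C_{h_r} is at least h_r·a₁, which exceeds
-- the r − 1 further sums h·a₁ ∈ hA for h ∈ H ∖ {h_r}; so |HA| ≥ h_r(k − 1) + r.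
-- For A = [1,k] and H = [1,r] this is sharp since HA ⊆ [1, rk].
module Submission where

open import Defs
open import Data.Nat using (ℕ; zero; suc; _+_; _*_; _∸_; _≤_; _<_; z≤n; s≤s; NonZero; >-nonZero)
open import Data.Nat.Properties
open import Data.Product using (_×_; _,_; ∃; proj₁; proj₂)
open import Data.Sum using (inj₁; inj₂)
open import Data.List using (List; []; _∷_; length; map; _++_; upTo; deduplicate)
open import Data.List.Properties using (length-map; length-++; length-applyUpTo)
open import Data.List.Extrema.Nat using (min; max; argmin-sel; argmax-sel; min≤⊤; min≤xs; ⊥≤max; xs≤max)
open import Data.List.Relation.Unary.All as All using (All; []; _∷_)
open import Data.List.Relation.Unary.Any as Any using (here; there)
open import Data.List.Relation.Unary.Unique.Propositional using (Unique)
open import Data.List.Relation.Unary.Unique.Propositional.Properties using (map⁺; ++⁺; upTo⁺)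
open import Data.List.Relation.Unary.Unique.DecPropositional.Properties using (deduplicate-!)
open import Data.List.Relation.Unary.AllPairs using ([]; _∷_)
open import Data.List.Relation.Binary.Disjoint.Propositional using (Disjoint)
open import Data.List.Relation.Binary.Subset.Propositional using (_⊆_)
open import Data.List.Membership.Propositional using (_∈_; _∉_; find)
open import Data.List.Membership.Propositional.Properties
open import Function using (id)
open import Relation.Binary.PropositionalEquality
open import Data.Empty using (⊥-elim)

module _ {a} {A : Set a} where

  Unique-remove : ∀ {xs : List A} {x} → Unique xs → x ∈ xs →
    ∃ λ ys → Unique ys × suc (length ys) ≡ length xs × ys ⊆ xs × x ∉ ys
  Unique-remove {_ ∷ xs} (x∉ ∷ u) (here refl) =
    xs , u , refl , there , λ x∈ → All.lookup x∉ x∈ refl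
  Unique-remove {y ∷ xs} (y∉ ∷ u) (there x∈) with Unique-remove u x∈
  ... | ys , uys , len , ys⊆ , x∉ =
    y ∷ ys , (All.tabulate (λ z∈ → All.lookup y∉ (ys⊆ z∈)) ∷ uys) , cong suc len ,
    (λ { (here refl) → here refl ; (there z∈) → there (ys⊆ z∈) }) ,
    λ { (here refl) → All.lookup y∉ x∈ refl ; (there x∈ys) → x∉ x∈ys }

  Unique-length-mono-⊆ : ∀ {xs ys : List A} → Unique xs → xs ⊆ ys → length xs ≤ length ys
  Unique-length-mono-⊆ {[]} _ _ = z≤n
  Unique-length-mono-⊆ {x ∷ xs} {ys} (x∉ ∷ u) x∷xs⊆ys with ∈-∃++ (x∷xs⊆ys (here refl))
  ... | ys₁ , ys₂ , refl = begin
      suc (length xs)                 ≤⟨ s≤s (Unique-length-mono-⊆ u xs⊆ys₁ys₂) ⟩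
      suc (length (ys₁ ++ ys₂))       ≡⟨ cong suc (length-++ ys₁) ⟩
      suc (length ys₁ + length ys₂)   ≡⟨ +-suc (length ys₁) (length ys₂) ⟨
      length ys₁ + length (x ∷ ys₂)   ≡⟨ length-++ ys₁ ⟨
      length (ys₁ ++ x ∷ ys₂)         ∎
    where
    open ≤-Reasoning
    xs⊆ys₁ys₂ : xs ⊆ ys₁ ++ ys₂
    xs⊆ys₁ys₂ z∈ with ∈-++⁻ ys₁ (x∷xs⊆ys (there z∈))
    ... | inj₁ z∈ys₁ = ∈-++⁺ˡ z∈ys₁
    ... | inj₂ (here refl) = ⊥-elim (All.lookup x∉ z∈ refl)
    ... | inj₂ (there z∈ys₂) = ∈-++⁺ʳ ys₁ z∈ys₂

<-separated⇒Disjoint : ∀ {xs ys} → (∀ {x y} → x ∈ xs → y ∈ ys → x < y) → Disjoint xs ys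
<-separated⇒Disjoint sep (x∈ , y∈) = <-irrefl refl (sep x∈ y∈)

min∈ : ∀ x xs → min x xs ∈ x ∷ xs
min∈ x xs with argmin-sel id x xs
... | inj₁ eq = here eq
... | inj₂ m∈ = there m∈

max∈ : ∀ x xs → max x xs ∈ x ∷ xs
max∈ x xs with argmax-sel id x xs
... | inj₁ eq = here eq
... | inj₂ m∈ = there m∈

∈-sumList-suc⁺ : ∀ A h {a s} → a ∈ A → s ∈ sumList h A → a + s ∈ sumList (suc h) A
∈-sumList-suc⁺ A h a∈ s∈ =
  ∈-concatMap⁺ (λ a → map (a +_) (sumList h A)) (Any.map (λ { refl → ∈-map⁺ _ s∈ }) a∈)

∈-sumList-suc⁻ : ∀ A h {s} → s ∈ sumList (suc h) A →
  ∃ λ a → ∃ λ t → a ∈ A × t ∈ sumList h A × s ≡ a + t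
∈-sumList-suc⁻ A h s∈ with find (∈-concatMap⁻ (λ a → map (a +_) (sumList h A)) s∈)
... | a , a∈ , s∈a+ with ∈-map⁻ (a +_) s∈a+
... | t , t∈ , s≡a+t = a , t , a∈ , t∈ , s≡a+t

*-∈-sumList : ∀ A h {a} → a ∈ A → h * a ∈ sumList h A
*-∈-sumList A zero    a∈ = here refl
*-∈-sumList A (suc h) a∈ = ∈-sumList-suc⁺ A h a∈ (*-∈-sumList A h a∈)

sumList-lowerBound : ∀ A h {m s} → All (m ≤_) A → s ∈ sumList h A → h * m ≤ s
sumList-lowerBound A zero    m≤A s∈ = z≤n
sumList-lowerBound A (suc h) m≤A s∈ with ∈-sumList-suc⁻ A h s∈
... | a , t , a∈ , t∈ , refl = +-mono-≤ (All.lookup m≤A a∈) (sumList-lowerBound A h m≤A t∈)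

sumList-upperBound : ∀ A h {M s} → All (_≤ M) A → s ∈ sumList h A → s ≤ h * M
sumList-upperBound A zero    A≤M (here refl) = z≤n
sumList-upperBound A (suc h) A≤M s∈ with ∈-sumList-suc⁻ A h s∈
... | a , t , a∈ , t∈ , refl = +-mono-≤ (All.lookup A≤M a∈) (sumList-upperBound A h A≤M t∈)

∈-HsumList⁺ : ∀ H A {h s} → h ∈ H → s ∈ sumList h A → s ∈ HsumList H A
∈-HsumList⁺ H A h∈ s∈ = ∈-concatMap⁺ (λ h → sumList h A) (Any.map (λ { refl → s∈ }) h∈)

∈-cardHA⁺ : ∀ H A {h s} → h ∈ H → s ∈ sumList h A → s ∈ deduplicate _≟_ (HsumList H A)
∈-cardHA⁺ H A h∈ s∈ = ∈-deduplicate⁺ _≟_ (∈-HsumList⁺ H A h∈ s∈)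

cardHA-≤ : ∀ H A {xs} → HsumList H A ⊆ xs → cardHA H A ≤ length xs
cardHA-≤ H A HA⊆xs =
  Unique-length-mono-⊆ (deduplicate-! _≟_ (HsumList H A)) (λ s∈ → HA⊆xs (∈-deduplicate⁻ _≟_ _ s∈))

module Chain (A T : List ℕ) {a₁ M : ℕ} (a₁∈A : a₁ ∈ A) (M∈A : M ∈ A) (A≤M : All (_≤ M) A)
             (T⊆A : T ⊆ A) (uT : Unique T) (a₁<T : All (a₁ <_) T) where

  chain : ℕ → List ℕ
  chain zero    = 0 ∷ []
  chain (suc h) = map (a₁ +_) (chain h) ++ map (_+ h * M) T

  chain⊆sumList : ∀ h → chain h ⊆ sumList h A
  chain⊆sumList zero    s∈ = s∈
  chain⊆sumList (suc h) s∈ with ∈-++⁻ (map (a₁ +_) (chain h)) s∈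
  ... | inj₁ s∈a₁+ with ∈-map⁻ (a₁ +_) s∈a₁+
  ...   | c , c∈ , refl = ∈-sumList-suc⁺ A h a₁∈A (chain⊆sumList h c∈)
  chain⊆sumList (suc h) s∈ | inj₂ s∈+hM with ∈-map⁻ (_+ h * M) s∈+hM
  ...   | t , t∈ , refl = ∈-sumList-suc⁺ A h (T⊆A t∈) (*-∈-sumList A h M∈A)

  chain-unique : ∀ h → Unique (chain h)
  chain-unique zero    = [] ∷ []
  chain-unique (suc h) =
    ++⁺ (map⁺ (+-cancelˡ-≡ a₁ _ _) (chain-unique h)) (map⁺ (+-cancelʳ-≡ (h * M) _ _) uT)
        (<-separated⇒Disjoint separated)
    where
    separated : ∀ {x y} → x ∈ map (a₁ +_) (chain h) → y ∈ map (_+ h * M) T → x < y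
    separated x∈ y∈ with ∈-map⁻ (a₁ +_) x∈ | ∈-map⁻ (_+ h * M) y∈
    ... | c , c∈ , refl | t , t∈ , refl =
      +-mono-<-≤ (All.lookup a₁<T t∈) (sumList-upperBound A h A≤M (chain⊆sumList h c∈))

  length-chain : ∀ h → length (chain h) ≡ suc (h * length T)
  length-chain zero    = refl
  length-chain (suc h) = begin
    length (map (a₁ +_) (chain h) ++ map (_+ h * M) T)             ≡⟨ length-++ (map (a₁ +_) (chain h)) ⟩
    length (map (a₁ +_) (chain h)) + length (map (_+ h * M) T)     ≡⟨ cong₂ _+_ (length-map _ (chain h)) (length-map _ T) ⟩
    length (chain h) + length T                                    ≡⟨ cong (_+ length T) (length-chain h) ⟩
    suc (h * length T + length T)                                  ≡⟨ cong suc (+-comm (h * length T) (length T)) ⟩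
    suc (suc h * length T)                                         ∎
    where open ≡-Reasoning

cardHA-lowerBound : (k r hr : ℕ) (A H : List ℕ) →
  1 ≤ k →
  Unique A → All (0 <_) A → length A ≡ k →
  Unique H → All (0 <_) H → length H ≡ r →
  hr ∈ H → All (_≤ hr) H →
  hr * (k ∸ 1) + r ≤ cardHA H A
cardHA-lowerBound k r hr [] H 1≤k uA 0<A refl = ⊥-elim (1+n≰n 1≤k)
cardHA-lowerBound k r hr A@(x ∷ xs) H 1≤k uA 0<A refl uH _ refl hr∈H H≤hr
  with Unique-remove uA (min∈ x xs) | Unique-remove uH hr∈H
... | T , uT , lenT , T⊆A , a₁∉T | H′ , uH′ , lenH′ , H′⊆H , hr∉H′ = begin
    hr * length xs + length H          ≡⟨ cong₂ (λ t h → hr * t + h) (suc-injective lenT) lenH′ ⟨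
    hr * length T + suc (length H′)    ≡⟨ +-comm (hr * length T) _ ⟩
    suc (length H′ + hr * length T)    ≡⟨ +-suc (length H′) _ ⟨
    length H′ + suc (hr * length T)    ≡⟨ length-P ⟨
    length P                           ≤⟨ Unique-length-mono-⊆ uP P⊆HA ⟩
    cardHA H A                         ∎
  where
  open ≤-Reasoning
  a₁ : ℕ
  a₁ = min x xs
  a₁≤A : All (a₁ ≤_) A
  a₁≤A = min≤⊤ x xs ∷ min≤xs x xs
  a₁<T : All (a₁ <_) T
  a₁<T = All.tabulate λ t∈ → ≤∧≢⇒< (All.lookup a₁≤A (T⊆A t∈)) λ { refl → a₁∉T t∈ }
  open Chain A T (min∈ x xs) (max∈ x xs) (⊥≤max x xs ∷ xs≤max x xs) T⊆A uT a₁<T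
  instance
    a₁-nonZero : NonZero a₁
    a₁-nonZero = >-nonZero (All.lookup 0<A (min∈ x xs))
  P : List ℕ
  P = map (_* a₁) H′ ++ chain hr
  length-P : length P ≡ length H′ + suc (hr * length T)
  length-P = trans (length-++ (map (_* a₁) H′)) (cong₂ _+_ (length-map (_* a₁) H′) (length-chain hr))
  uP : Unique P
  uP = ++⁺ (map⁺ (*-cancelʳ-≡ _ _ a₁) uH′) (chain-unique hr) (<-separated⇒Disjoint separated)
    where
    separated : ∀ {x y} → x ∈ map (_* a₁) H′ → y ∈ chain hr → x < y
    separated x∈ y∈ with ∈-map⁻ (_* a₁) x∈
    ... | h , h∈ , refl = <-≤-trans
      (*-monoˡ-< a₁ (≤∧≢⇒< (All.lookup H≤hr (H′⊆H h∈)) λ { refl → hr∉H′ h∈ }))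
      (sumList-lowerBound A hr a₁≤A (chain⊆sumList hr y∈))
  P⊆HA : P ⊆ deduplicate _≟_ (HsumList H A)
  P⊆HA s∈ with ∈-++⁻ (map (_* a₁) H′) s∈
  ... | inj₁ s∈H′a₁ with ∈-map⁻ (_* a₁) s∈H′a₁
  ...   | h , h∈ , refl = ∈-cardHA⁺ H A (H′⊆H h∈) (*-∈-sumList A h (min∈ x xs))
  P⊆HA s∈ | inj₂ s∈chain = ∈-cardHA⁺ H A hr∈H (chain⊆sumList hr s∈chain)

interval1-unique : ∀ n → Unique (interval1 n)
interval1-unique n = map⁺ suc-injective (upTo⁺ n)

length-interval1 : ∀ n → length (interval1 n) ≡ n
length-interval1 n = trans (length-map suc (upTo n)) (length-applyUpTo id n)

∈-interval1⁻ : ∀ {n z} → z ∈ interval1 n → 1 ≤ z × z ≤ n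
∈-interval1⁻ z∈ with ∈-map⁻ suc z∈
... | i , i∈ , refl = s≤s z≤n , ∈-upTo⁻ i∈

∈-interval1⁺ : ∀ {n z} → 1 ≤ z → z ≤ n → z ∈ interval1 n
∈-interval1⁺ {z = suc z} _ z<n = ∈-map⁺ suc (∈-upTo⁺ z<n)

interval1-positive : ∀ n → All (0 <_) (interval1 n)
interval1-positive n = All.tabulate (λ z∈ → proj₁ (∈-interval1⁻ z∈))

interval1-bounded : ∀ n → All (_≤ n) (interval1 n)
interval1-bounded n = All.tabulate (λ z∈ → proj₂ (∈-interval1⁻ z∈))

HsumList-interval1⊆interval1 : ∀ r k → HsumList (interval1 r) (interval1 k) ⊆ interval1 (r * k)
HsumList-interval1⊆interval1 r k s∈
  with find (∈-concatMap⁻ (λ h → sumList h (interval1 k)) {xs = interval1 r} s∈)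
... | h , h∈ , s∈hA = ∈-interval1⁺
  (≤-trans (*-monoˡ-≤ 1 (proj₁ (∈-interval1⁻ h∈))) (sumList-lowerBound (interval1 k) h (interval1-positive k) s∈hA))
  (≤-trans (sumList-upperBound (interval1 k) h (interval1-bounded k) s∈hA) (*-monoˡ-≤ k (proj₂ (∈-interval1⁻ h∈))))

cardHA-interval1 : ∀ k r → 1 ≤ k → 1 ≤ r → cardHA (interval1 r) (interval1 k) ≡ r * (k ∸ 1) + r
cardHA-interval1 k@(suc k′) r 1≤k 1≤r = ≤-antisym upper lower
  where
  upper : cardHA (interval1 r) (interval1 k) ≤ r * k′ + r
  upper = begin
    cardHA (interval1 r) (interval1 k)    ≤⟨ cardHA-≤ (interval1 r) (interval1 k) (HsumList-interval1⊆interval1 r k) ⟩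
    length (interval1 (r * k))            ≡⟨ length-interval1 (r * k) ⟩
    r * suc k′                            ≡⟨ *-suc r k′ ⟩
    r + r * k′                            ≡⟨ +-comm r (r * k′) ⟩
    r * k′ + r                            ∎
    where open ≤-Reasoning
  lower : r * k′ + r ≤ cardHA (interval1 r) (interval1 k)
  lower = cardHA-lowerBound k r r (interval1 k) (interval1 r) 1≤k
    (interval1-unique k) (interval1-positive k) (length-interval1 k)
    (interval1-unique r) (interval1-positive r) (length-interval1 r)
    (∈-interval1⁺ 1≤r ≤-refl) (interval1-bounded r)

theorem3 :
    ((k r hr : ℕ) (A H : List ℕ) →
      1 ≤ k →
      Unique A → All (0 <_) A → length A ≡ k →
      Unique H → All (0 <_) H → length H ≡ r →
      hr ∈ H → All (_≤ hr) H →
      hr * (k ∸ 1) + r ≤ cardHA H A)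
    ×
    ((k r : ℕ) → 1 ≤ k → 1 ≤ r →
      cardHA (interval1 r) (interval1 k) ≡ r * (k ∸ 1) + r)
theorem3 = cardHA-lowerBound , cardHA-interval1
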